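{- For the hypercube $Q_n$, $n\ge2$: (1) $str(Q_2)\ge 6$, $str(Q_3)\ge 11$, $str(Q_4)\ge 21$; (2) $str(Q_n)\ge 2^n+4n-12$ for $5\le n\le 9$; (3) $str(Q_{2m})\ge 2^{2m}+m^2+4$ for $m\ge 5$; (4) $str(Q_{2m-1})\ge 2^{2m-1}+m^2-m+4$ for $m\ge 6$.
   Context: $Q_n$ has vertex set $\{0,1\}^n$, two vertices adjacent iff they differ in exactly one coordinate. For a graph $G$ of order $p$, a numbering is a bijection $f:V(G)\to\{1,\dots,p\}$; $str_f(G)=\max\{f(u)+f(v): uv\in E(G)\}$ and $str(G)=\min\{str_f(G)\}$ over numberings. -}

module Defs where

open import Data.Nat using (ℕ; zero; suc; _+_; _^_; _≥_)
open import Data.Bool using (Bool; true; false; _xor_)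
open import Data.Vec using (Vec; []; _∷_)
open import Data.Fin using (Fin; toℕ)
open import Data.Product using (Σ; _×_)
open import Function.Bundles using (_⤖_; Bijection)
open import Relation.Binary.PropositionalEquality using (_≡_)

Vertex : ℕ → Set
Vertex n = Vec Bool n

hamming : ∀ {n} → Vertex n → Vertex n → ℕ
hamming []       []       = 0
hamming (x ∷ xs) (y ∷ ys) with x xor y
... | true  = suc (hamming xs ys)
... | false = hamming xs ys

Adj : ∀ {n} → Vertex n → Vertex n → Set
Adj u v = hamming u v ≡ 1

-- A numbering of Q_n (order p = 2^n): a bijection V(Q_n) → {1,…,2^n},
-- represented as a bijection onto Fin (2^n) shifted by one.
Numbering : ℕ → Set
Numbering n = Vertex n ⤖ Fin (2 ^ n)

label : ∀ {n} → Numbering n → Vertex n → ℕ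
label f v = suc (toℕ (Bijection.to f v))

-- str_f(Q_n) ≥ k  ⟺  some edge uv has f(u)+f(v) ≥ k  (max over edges ≥ k).
StrfAtLeast : ∀ {n} → Numbering n → ℕ → Set
StrfAtLeast {n} f k =
  Σ (Vertex n) λ u → Σ (Vertex n) λ v → Adj u v × (label f u + label f v ≥ k)

-- str(Q_n) ≥ k  ⟺  every numbering f has str_f(Q_n) ≥ k  (min over numberings ≥ k).
StrAtLeast : ℕ → ℕ → Set
StrAtLeast n k = (f : Numbering n) → StrfAtLeast f k

-- Let A be the k vertices carrying the largest labels 2^n − k + 1, …, 2^n. If more than t
-- vertices are adjacent to A, one of them carries a label ≥ t + 1, and the edge joining it
-- to A has label sum ≥ (t + 1) + (2^n − k + 1). So it suffices to show that k-sets of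
-- vertices of Q_n have many neighbours. Writing d(x) for the number of vertices of A
-- adjacent to x, there are kn − Σₓ (d(x) − 1)⁺ of them. Two distinct vertices have at most
-- two common neighbours, so adding a vertex to A raises this excess by at most 2|A|, and
-- the excess is at most k(k − 1). For k ≥ 4, four of the vertices save 3 more: on them the
-- excess is Σ_pairs codeg − Σₓ C(d(x) − 1, 2), and either two of the six pairs are not at
-- distance 2, or some three points are pairwise at distance 2; their coordinatewise
-- majority is then a common neighbour of all three and contributes to the second sum
-- (three times over when all six pairs are at distance 2). Parts (1)–(4) take k = 1, 2, 4
-- and m.

module Submission where

open import Defs

open import Data.Bool using (Bool; true; false; T; _∧_; _∨_; if_then_else_)
import Data.Bool as Bool
open import Data.Bool.Properties using (T-∧; T-∨)
open import Data.Empty using (⊥-elim)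
open import Data.Fin using (toℕ; fromℕ<)
open import Data.Fin.Properties using (toℕ-injective; toℕ-fromℕ<)
open import Data.List using (List; []; _∷_; length; map)
open import Data.List.Relation.Binary.Sublist.Propositional using (_⊆_; []; _∷_; _∷ʳ_; ⊆-refl)
open import Data.List.Relation.Unary.All as All using (All; []; _∷_)
open import Data.List.Relation.Unary.AllPairs using (AllPairs; []; _∷_)
open import Data.Nat
  using (ℕ; zero; suc; _+_; _*_; _∸_; _^_; _⊓_; _≤_; _<_; z≤n; s≤s; _≤ᵇ_; _<ᵇ_; _≡ᵇ_; _≟_; _≤?_)
open import Data.Nat.Combinatorics using (_C_; nC1≡n; nCk+nC[k+1]≡[n+1]C[k+1])
open import Data.Nat.ListAction using (sum)
open import Data.Nat.Properties
open import Algebra.Properties.CommutativeSemigroup +-commutativeSemigroup using (interchange; xy∙z≈xz∙y)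
open import Data.Nat.Tactic.RingSolver using (solve-∀)
open import Data.Product using (Σ; _×_; _,_; proj₁; proj₂)
open import Data.Sum using (_⊎_; inj₁; inj₂)
open import Data.Vec using (Vec; []; _∷_)
open import Data.Vec.Properties using (≡-dec)
open import Function using (_∘_)
open import Function.Definitions using (Injective)
open import Function.Bundles using (Bijection; Equivalence)
open import Relation.Binary.PropositionalEquality
open import Relation.Nullary using (Dec; yes; no)
open import Relation.Nullary.Decidable
  using (map′; _×-dec_; _⊎-dec_; ¬?; False; toWitnessFalse; decidable-stable)

𝟙 : Bool → ℕ
𝟙 true  = 1
𝟙 false = 0

𝟙-T : ∀ {b} → T b → 𝟙 b ≡ 1
𝟙-T {true} _ = refl

adj : ∀ {n} → Vertex n → Vertex n → ℕ
adj x a = 𝟙 (hamming x a ≡ᵇ 1)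

δ : ∀ {n} → Vertex n → Vertex n → ℕ
δ x a = 𝟙 (hamming x a ≡ᵇ 0)

hamming-refl : ∀ {n} (a : Vertex n) → hamming a a ≡ 0
hamming-refl []          = refl
hamming-refl (true  ∷ a) = hamming-refl a
hamming-refl (false ∷ a) = hamming-refl a

hamming-sym : ∀ {n} (a b : Vertex n) → hamming a b ≡ hamming b a
hamming-sym []          []          = refl
hamming-sym (true  ∷ a) (true  ∷ b) = hamming-sym a b
hamming-sym (true  ∷ a) (false ∷ b) = cong suc (hamming-sym a b)
hamming-sym (false ∷ a) (true  ∷ b) = cong suc (hamming-sym a b)
hamming-sym (false ∷ a) (false ∷ b) = hamming-sym a b

hamming≡0⇒≡ : ∀ {n} {a b : Vertex n} → hamming a b ≡ 0 → a ≡ b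
hamming≡0⇒≡ {a = []}        {[]}        _ = refl
hamming≡0⇒≡ {a = true  ∷ a} {true  ∷ b} e = cong (true ∷_) (hamming≡0⇒≡ e)
hamming≡0⇒≡ {a = false ∷ a} {false ∷ b} e = cong (false ∷_) (hamming≡0⇒≡ e)

δ-refl : ∀ {n} (a : Vertex n) → δ a a ≡ 1
δ-refl a rewrite hamming-refl a = refl

δ-≢ : ∀ {n} {x a : Vertex n} → x ≢ a → δ x a ≡ 0
δ-≢ {x = x} {a} x≢a with hamming x a in eq
... | zero  = ⊥-elim (x≢a (hamming≡0⇒≡ eq))
... | suc _ = refl

_≟ᵥ_ : ∀ {n} (x y : Vertex n) → Dec (x ≡ y)
_≟ᵥ_ = ≡-dec Bool._≟_

Distinct : ∀ {n} → List (Vertex n) → Set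
Distinct = AllPairs _≢_

-- Sums and searches over the vertices of Q_n

sumᵥ : ∀ {n} → (Vertex n → ℕ) → ℕ
sumᵥ {zero}  g = g []
sumᵥ {suc n} g = sumᵥ (λ x → g (true ∷ x)) + sumᵥ (λ x → g (false ∷ x))

sumᵥ-cong : ∀ {n} {g h : Vertex n → ℕ} → (∀ x → g x ≡ h x) → sumᵥ g ≡ sumᵥ h
sumᵥ-cong {zero}  e = e []
sumᵥ-cong {suc n} e = cong₂ _+_ (sumᵥ-cong (e ∘ (true ∷_))) (sumᵥ-cong (e ∘ (false ∷_)))

sumᵥ-mono-≤ : ∀ {n} {g h : Vertex n → ℕ} → (∀ x → g x ≤ h x) → sumᵥ g ≤ sumᵥ h
sumᵥ-mono-≤ {zero}  le = le []
sumᵥ-mono-≤ {suc n} le = +-mono-≤ (sumᵥ-mono-≤ (le ∘ (true ∷_))) (sumᵥ-mono-≤ (le ∘ (false ∷_)))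

sumᵥ-+ : ∀ {n} (g h : Vertex n → ℕ) → sumᵥ (λ x → g x + h x) ≡ sumᵥ g + sumᵥ h
sumᵥ-+ {zero}  g h = refl
sumᵥ-+ {suc n} g h =
  trans (cong₂ _+_ (sumᵥ-+ (g ∘ (true ∷_)) (h ∘ (true ∷_))) (sumᵥ-+ (g ∘ (false ∷_)) (h ∘ (false ∷_))))
        (interchange (sumᵥ (g ∘ (true ∷_))) (sumᵥ (h ∘ (true ∷_)))
                     (sumᵥ (g ∘ (false ∷_))) (sumᵥ (h ∘ (false ∷_))))

sumᵥ-zero : ∀ {n} → sumᵥ {n} (λ _ → 0) ≡ 0
sumᵥ-zero {zero}  = refl
sumᵥ-zero {suc n} = cong₂ _+_ (sumᵥ-zero {n}) (sumᵥ-zero {n})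

sumᵥ-δ : ∀ {n} (a : Vertex n) (g : Vertex n → ℕ) → sumᵥ (λ x → δ x a * g x) ≡ g a
sumᵥ-δ []          g = +-identityʳ (g [])
sumᵥ-δ {suc n} (true  ∷ a) g =
  trans (cong₂ _+_ (sumᵥ-δ a (g ∘ (true ∷_))) (sumᵥ-zero {n})) (+-identityʳ (g (true ∷ a)))
sumᵥ-δ {suc n} (false ∷ a) g = cong₂ _+_ (sumᵥ-zero {n}) (sumᵥ-δ a (g ∘ (false ∷_)))

sumᵥ-δʳ : ∀ {n} (a : Vertex n) (g : Vertex n → ℕ) → sumᵥ (λ x → g x * δ x a) ≡ g a
sumᵥ-δʳ a g = trans (sumᵥ-cong (λ x → *-comm (g x) (δ x a))) (sumᵥ-δ a g)

sumᵥ-δ≡1 : ∀ {n} (a : Vertex n) → sumᵥ (λ x → δ x a) ≡ 1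
sumᵥ-δ≡1 a = trans (sumᵥ-cong (λ x → sym (*-identityʳ (δ x a)))) (sumᵥ-δ a (λ _ → 1))

sum-δ-≢ : ∀ {n} {x : Vertex n} {M} → All (x ≢_) M → sum (map (δ x) M) ≡ 0
sum-δ-≢ []           = refl
sum-δ-≢ (x≢m ∷ x≢M) = cong₂ _+_ (δ-≢ x≢m) (sum-δ-≢ x≢M)

sum-δ-≤1 : ∀ {n} (x : Vertex n) {M} → Distinct M → sum (map (δ x) M) ≤ 1
sum-δ-≤1 x {[]}    []            = z≤n
sum-δ-≤1 x {m ∷ M} (m≢M ∷ distM) with x ≟ᵥ m
... | yes refl = ≤-reflexive (cong₂ _+_ (δ-refl x) (sum-δ-≢ m≢M))
... | no  x≢m  rewrite δ-≢ x≢m = sum-δ-≤1 x distM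

sum-map-as-sumᵥ : ∀ {n} (g : Vertex n → ℕ) M → sum (map g M) ≡ sumᵥ (λ x → sum (map (δ x) M) * g x)
sum-map-as-sumᵥ {n} g []      = sym (sumᵥ-zero {n})
sum-map-as-sumᵥ g (m ∷ M) = begin
  g m + sum (map g M)
    ≡⟨ cong₂ _+_ (sym (sumᵥ-δ m g)) (sum-map-as-sumᵥ g M) ⟩
  sumᵥ (λ x → δ x m * g x) + sumᵥ (λ x → sum (map (δ x) M) * g x)
    ≡⟨ sym (sumᵥ-+ (λ x → δ x m * g x) (λ x → sum (map (δ x) M) * g x)) ⟩
  sumᵥ (λ x → δ x m * g x + sum (map (δ x) M) * g x)
    ≡⟨ sumᵥ-cong (λ x → sym (*-distribʳ-+ (g x) (δ x m) _)) ⟩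
  sumᵥ (λ x → sum (map (δ x) (m ∷ M)) * g x) ∎
  where open ≡-Reasoning

sum-map-≤-sumᵥ : ∀ {n} (g : Vertex n → ℕ) {M} → Distinct M → sum (map g M) ≤ sumᵥ g
sum-map-≤-sumᵥ g {M} distM = begin
  sum (map g M)                          ≡⟨ sum-map-as-sumᵥ g M ⟩
  sumᵥ (λ x → sum (map (δ x) M) * g x)   ≤⟨ sumᵥ-mono-≤ (λ x → *-monoˡ-≤ (g x) (sum-δ-≤1 x distM)) ⟩
  sumᵥ (λ x → 1 * g x)                   ≡⟨ sumᵥ-cong (λ x → *-identityˡ (g x)) ⟩
  sumᵥ g                                 ∎
  where open ≤-Reasoning

term-≤-sumᵥ : ∀ {n} (g : Vertex n → ℕ) y → g y ≤ sumᵥ g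
term-≤-sumᵥ g y = ≤-trans (m≤m+n (g y) 0) (sum-map-≤-sumᵥ g (All.[] ∷ []))

∃ᵥ? : ∀ {n} {P : Vertex n → Set} → (∀ x → Dec (P x)) → Dec (Σ (Vertex n) P)
∃ᵥ? {zero}      P? = map′ ([] ,_) (λ { ([] , p) → p }) (P? [])
∃ᵥ? {suc n} {P} P? = map′ join split (∃ᵥ? (P? ∘ (true ∷_)) ⊎-dec ∃ᵥ? (P? ∘ (false ∷_)))
  where
  join : Σ _ (P ∘ (true ∷_)) ⊎ Σ _ (P ∘ (false ∷_)) → Σ (Vertex (suc n)) P
  join (inj₁ (x , p)) = true ∷ x , p
  join (inj₂ (x , p)) = false ∷ x , p
  split : Σ (Vertex (suc n)) P → Σ _ (P ∘ (true ∷_)) ⊎ Σ _ (P ∘ (false ∷_))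
  split (true  ∷ x , p) = inj₁ (x , p)
  split (false ∷ x , p) = inj₂ (x , p)

∀ᵥ-by-search : ∀ {n} {P : Vertex n → Set} (P? : ∀ x → Dec (P x)) →
               False (∃ᵥ? (λ x → ¬? (P? x))) → ∀ x → P x
∀ᵥ-by-search P? no-counterexample x =
  decidable-stable (P? x) (λ ¬Px → toWitnessFalse no-counterexample (x , ¬Px))

count-≡-≤1 : ∀ {n} (h : Vertex n → ℕ) → Injective _≡_ _≡_ h → ∀ t →
             sumᵥ (λ x → 𝟙 (h x ≡ᵇ t)) ≤ 1
count-≡-≤1 {n} h h-inj t with ∃ᵥ? (λ x → h x ≟ t)
... | yes (x₀ , hx₀≡t) = begin
  sumᵥ (λ x → 𝟙 (h x ≡ᵇ t)) ≤⟨ sumᵥ-mono-≤ at-most-x₀ ⟩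
  sumᵥ (λ x → δ x x₀)       ≡⟨ sumᵥ-δ≡1 x₀ ⟩
  1                         ∎
  where
  open ≤-Reasoning
  at-most-x₀ : ∀ x → 𝟙 (h x ≡ᵇ t) ≤ δ x x₀
  at-most-x₀ x with h x ≡ᵇ t in eq
  ... | false = z≤n
  ... | true with h-inj (trans (≡ᵇ⇒≡ (h x) t (subst T (sym eq) _)) (sym hx₀≡t))
  ...   | refl = ≤-reflexive (sym (δ-refl x))
... | no ∄x = ≤-trans (≤-reflexive (trans (sumᵥ-cong none) (sumᵥ-zero {n}))) z≤n
  where
  none : ∀ x → 𝟙 (h x ≡ᵇ t) ≡ 0
  none x with h x ≡ᵇ t in eq
  ... | false = refl
  ... | true  = ⊥-elim (∄x (x , ≡ᵇ⇒≡ (h x) t (subst T (sym eq) _)))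

𝟙<ᵇ-suc : ∀ m t → 𝟙 (m <ᵇ suc t) ≡ 𝟙 (m <ᵇ t) + 𝟙 (m ≡ᵇ t)
𝟙<ᵇ-suc zero    zero    = refl
𝟙<ᵇ-suc zero    (suc t) = refl
𝟙<ᵇ-suc (suc m) zero    = refl
𝟙<ᵇ-suc (suc m) (suc t) = 𝟙<ᵇ-suc m t

count-<-≤ : ∀ {n} (h : Vertex n → ℕ) → Injective _≡_ _≡_ h → ∀ t →
            sumᵥ (λ x → 𝟙 (h x <ᵇ t)) ≤ t
count-<-≤ {n} h h-inj zero    = ≤-reflexive (sumᵥ-zero {n})
count-<-≤ h h-inj (suc t) = begin
  sumᵥ (λ x → 𝟙 (h x <ᵇ suc t))
    ≡⟨ sumᵥ-cong (λ x → 𝟙<ᵇ-suc (h x) t) ⟩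
  sumᵥ (λ x → 𝟙 (h x <ᵇ t) + 𝟙 (h x ≡ᵇ t))
    ≡⟨ sumᵥ-+ (λ x → 𝟙 (h x <ᵇ t)) (λ x → 𝟙 (h x ≡ᵇ t)) ⟩
  sumᵥ (λ x → 𝟙 (h x <ᵇ t)) + sumᵥ (λ x → 𝟙 (h x ≡ᵇ t))
    ≤⟨ +-mono-≤ (count-<-≤ h h-inj t) (count-≡-≤1 h h-inj t) ⟩
  t + 1
    ≡⟨ +-comm t 1 ⟩
  suc t ∎
  where open ≤-Reasoning

C₂-suc : ∀ k → suc k C 2 ≡ k + k C 2
C₂-suc k = trans (sym (nCk+nC[k+1]≡[n+1]C[k+1] k 1)) (cong (_+ k C 2) (nC1≡n k))

C₂-𝟙+ : ∀ b d → (𝟙 b + d) C 2 ≡ 𝟙 b * d + d C 2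
C₂-𝟙+ false d = refl
C₂-𝟙+ true  d = trans (C₂-suc d) (cong (_+ d C 2) (sym (+-identityʳ d)))

C₂-mono-≤ : ∀ {m n} → m ≤ n → m C 2 ≤ n C 2
C₂-mono-≤ {zero}          _         = z≤n
C₂-mono-≤ {suc m} {suc n} (s≤s m≤n) =
  subst₂ _≤_ (sym (C₂-suc m)) (sym (C₂-suc n)) (+-mono-≤ m≤n (C₂-mono-≤ m≤n))

2C₂-suc : ∀ k → 2 * (k C 2) + 2 * k ≡ 2 * (suc k C 2)
2C₂-suc k = begin
  2 * (k C 2) + 2 * k   ≡⟨ sym (*-distribˡ-+ 2 (k C 2) k) ⟩
  2 * (k C 2 + k)       ≡⟨ cong (2 *_) (trans (+-comm (k C 2) k) (sym (C₂-suc k))) ⟩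
  2 * (suc k C 2)       ∎
  where open ≡-Reasoning

2C₂+k≡k*k : ∀ k → 2 * (k C 2) + k ≡ k * k
2C₂+k≡k*k zero    = refl
2C₂+k≡k*k (suc k) = begin
  2 * (suc k C 2) + suc k            ≡⟨ cong (λ c → 2 * c + suc k) (C₂-suc k) ⟩
  2 * (k + k C 2) + suc k            ≡⟨ regroup k (k C 2) ⟩
  (2 * (k C 2) + k) + (2 * k + 1)    ≡⟨ cong (_+ (2 * k + 1)) (2C₂+k≡k*k k) ⟩
  k * k + (2 * k + 1)                ≡⟨ square-suc k ⟩
  suc k * suc k                      ∎
  where
  open ≡-Reasoning
  regroup : ∀ k c → 2 * (k + c) + suc k ≡ (2 * c + k) + (2 * k + 1)
  regroup = solve-∀
  square-suc : ∀ k → k * k + (2 * k + 1) ≡ suc k * suc k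
  square-suc = solve-∀

-- Common neighbours

codeg : ∀ {n} → Vertex n → Vertex n → ℕ
codeg a b = sumᵥ (λ x → adj x a * adj x b)

codegAt : ℕ → ℕ → ℕ
codegAt n 0 = n
codegAt n 2 = 2
codegAt n _ = 0

codegAt-+δ : ∀ n h → codegAt n h + 𝟙 (h ≡ᵇ 0) ≡ codegAt (suc n) h
codegAt-+δ n zero                = +-comm n 1
codegAt-+δ n (suc zero)          = refl
codegAt-+δ n (suc (suc zero))    = refl
codegAt-+δ n (suc (suc (suc h))) = refl

codegAt-suc : ∀ n h → 𝟙 (h ≡ᵇ 1) + 𝟙 (h ≡ᵇ 1) ≡ codegAt n (suc h)
codegAt-suc n zero          = refl
codegAt-suc n (suc zero)    = refl
codegAt-suc n (suc (suc h)) = refl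

codeg-hamming : ∀ {n} (a b : Vertex n) → codeg a b ≡ codegAt n (hamming a b)
codeg-hamming [] [] = refl
codeg-hamming {suc n} (true ∷ a) (true ∷ b) = begin
  codeg a b + sumᵥ (λ x → δ x a * δ x b)    ≡⟨ cong₂ _+_ (codeg-hamming a b) (sumᵥ-δ a (λ x → δ x b)) ⟩
  codegAt n (hamming a b) + δ a b           ≡⟨ codegAt-+δ n (hamming a b) ⟩
  codegAt (suc n) (hamming a b)             ∎
  where open ≡-Reasoning
codeg-hamming {suc n} (false ∷ a) (false ∷ b) = begin
  sumᵥ (λ x → δ x a * δ x b) + codeg a b    ≡⟨ cong₂ _+_ (sumᵥ-δ a (λ x → δ x b)) (codeg-hamming a b) ⟩
  δ a b + codegAt n (hamming a b)           ≡⟨ +-comm (δ a b) _ ⟩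
  codegAt n (hamming a b) + δ a b           ≡⟨ codegAt-+δ n (hamming a b) ⟩
  codegAt (suc n) (hamming a b)             ∎
  where open ≡-Reasoning
codeg-hamming {suc n} (true ∷ a) (false ∷ b) = begin
  sumᵥ (λ x → adj x a * δ x b) + sumᵥ (λ x → δ x a * adj x b)
    ≡⟨ cong₂ _+_ (sumᵥ-δʳ b (λ x → adj x a)) (sumᵥ-δ a (λ x → adj x b)) ⟩
  𝟙 (hamming b a ≡ᵇ 1) + 𝟙 (hamming a b ≡ᵇ 1)
    ≡⟨ cong (λ h → 𝟙 (h ≡ᵇ 1) + 𝟙 (hamming a b ≡ᵇ 1)) (hamming-sym b a) ⟩
  𝟙 (hamming a b ≡ᵇ 1) + 𝟙 (hamming a b ≡ᵇ 1)
    ≡⟨ codegAt-suc (suc n) (hamming a b) ⟩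
  codegAt (suc n) (suc (hamming a b)) ∎
  where open ≡-Reasoning
codeg-hamming {suc n} (false ∷ a) (true ∷ b) = begin
  sumᵥ (λ x → δ x a * adj x b) + sumᵥ (λ x → adj x a * δ x b)
    ≡⟨ cong₂ _+_ (sumᵥ-δ a (λ x → adj x b)) (sumᵥ-δʳ b (λ x → adj x a)) ⟩
  𝟙 (hamming a b ≡ᵇ 1) + 𝟙 (hamming b a ≡ᵇ 1)
    ≡⟨ cong (λ h → 𝟙 (hamming a b ≡ᵇ 1) + 𝟙 (h ≡ᵇ 1)) (hamming-sym b a) ⟩
  𝟙 (hamming a b ≡ᵇ 1) + 𝟙 (hamming a b ≡ᵇ 1)
    ≡⟨ codegAt-suc (suc n) (hamming a b) ⟩
  codegAt (suc n) (suc (hamming a b)) ∎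
  where open ≡-Reasoning

codeg-≢ : ∀ {n} {a b : Vertex n} → a ≢ b → codeg a b ≡ 2 * 𝟙 (hamming a b ≡ᵇ 2)
codeg-≢ {a = a} {b} a≢b rewrite codeg-hamming a b with hamming a b in eq
... | zero                = ⊥-elim (a≢b (hamming≡0⇒≡ eq))
... | suc zero            = refl
... | suc (suc zero)      = refl
... | suc (suc (suc _))   = refl

codeg-≤ : ∀ {n} {a b : Vertex n} → a ≢ b → codeg a b ≤ 2
codeg-≤ {a = a} {b} a≢b rewrite codeg-≢ a≢b with hamming a b ≡ᵇ 2
... | true  = ≤-refl
... | false = z≤n

-- Medians

majority : Bool → Bool → Bool → Bool
majority true  true  _ = true
majority false false _ = false
majority true  false z = z
majority false true  z = z

majority-swap₁₂ : ∀ x y z → majority x y z ≡ majority y x z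
majority-swap₁₂ true  true  z = refl
majority-swap₁₂ true  false z = refl
majority-swap₁₂ false true  z = refl
majority-swap₁₂ false false z = refl

majority-swap₂₃ : ∀ x y z → majority x y z ≡ majority x z y
majority-swap₂₃ true  true  true  = refl
majority-swap₂₃ true  true  false = refl
majority-swap₂₃ true  false true  = refl
majority-swap₂₃ true  false false = refl
majority-swap₂₃ false true  true  = refl
majority-swap₂₃ false true  false = refl
majority-swap₂₃ false false true  = refl
majority-swap₂₃ false false false = refl

median : ∀ {n} → Vertex n → Vertex n → Vertex n → Vertex n
median []      []      []      = []
median (x ∷ u) (y ∷ v) (z ∷ w) = majority x y z ∷ median u v w

median-swap₁₂ : ∀ {n} (u v w : Vertex n) → median u v w ≡ median v u w
median-swap₁₂ []      []      []      = refl
median-swap₁₂ (x ∷ u) (y ∷ v) (z ∷ w) = cong₂ _∷_ (majority-swap₁₂ x y z) (median-swap₁₂ u v w)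

median-swap₂₃ : ∀ {n} (u v w : Vertex n) → median u v w ≡ median u w v
median-swap₂₃ []      []      []      = refl
median-swap₂₃ (x ∷ u) (y ∷ v) (z ∷ w) = cong₂ _∷_ (majority-swap₂₃ x y z) (median-swap₂₃ u v w)

median-geodesic : ∀ {n} (u v w : Vertex n) →
                  hamming u v ≡ hamming (median u v w) u + hamming (median u v w) v
median-geodesic []          []          []          = refl
median-geodesic (true  ∷ u) (true  ∷ v) (z     ∷ w) = median-geodesic u v w
median-geodesic (false ∷ u) (false ∷ v) (z     ∷ w) = median-geodesic u v w
median-geodesic (true  ∷ u) (false ∷ v) (true  ∷ w) =
  trans (cong suc (median-geodesic u v w)) (sym (+-suc _ _))
median-geodesic (true  ∷ u) (false ∷ v) (false ∷ w) = cong suc (median-geodesic u v w)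
median-geodesic (false ∷ u) (true  ∷ v) (true  ∷ w) = cong suc (median-geodesic u v w)
median-geodesic (false ∷ u) (true  ∷ v) (false ∷ w) =
  trans (cong suc (median-geodesic u v w)) (sym (+-suc _ _))

pairwise-sums-2 : ∀ x y z → x + y ≡ 2 → x + z ≡ 2 → y + z ≡ 2 → x ≡ 1 × y ≡ 1 × z ≡ 1
pairwise-sums-2 0                   _ _ refl refl ()
pairwise-sums-2 1                   _ _ refl refl refl = refl , refl , refl
pairwise-sums-2 2                   _ _ refl refl ()
pairwise-sums-2 (suc (suc (suc _))) _ _ ()   _    _

median-adjacent : ∀ {n} (u v w : Vertex n) → hamming u v ≡ 2 → hamming u w ≡ 2 → hamming v w ≡ 2 →
                  Adj (median u v w) u × Adj (median u v w) v × Adj (median u v w) w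
median-adjacent u v w uv≡2 uw≡2 vw≡2 =
  pairwise-sums-2 _ _ _ (trans (sym (median-geodesic u v w)) uv≡2)
                        (trans (sym geodesic-uw) uw≡2) (trans (sym geodesic-vw) vw≡2)
  where
  m = median u v w
  geodesic-uw : hamming u w ≡ hamming m u + hamming m w
  geodesic-uw rewrite median-swap₂₃ u v w = median-geodesic u w v
  geodesic-vw : hamming v w ≡ hamming m v + hamming m w
  geodesic-vw rewrite median-swap₁₂ u v w | median-swap₂₃ v u w = median-geodesic v w u

close : ∀ {n} → Vertex n → Vertex n → Bool
close a b = hamming a b ≡ᵇ 2

close⇒≡2 : ∀ {n} (a b : Vertex n) → T (close a b) → hamming a b ≡ 2
close⇒≡2 a b = ≡ᵇ⇒≡ (hamming a b) 2

median-adjacent-close : ∀ {n} (u v w : Vertex n) → T (close u v) → T (close u w) → T (close v w) →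
                        All (Adj (median u v w)) (u ∷ v ∷ w ∷ [])
median-adjacent-close u v w uv uw vw
  with median-adjacent u v w (close⇒≡2 u v uv) (close⇒≡2 u w uw) (close⇒≡2 v w vw)
... | m~u , m~v , m~w = m~u ∷ m~v ∷ m~w ∷ []

-- Neighbourhoods of sets of vertices

deg : ∀ {n} → List (Vertex n) → Vertex n → ℕ
deg A x = sum (map (adj x) A)

neighbourhoodSize : ∀ {n} → List (Vertex n) → ℕ
neighbourhoodSize A = sumᵥ (λ x → 1 ⊓ deg A x)

excess : ∀ {n} → List (Vertex n) → ℕ
excess A = sumᵥ (λ x → deg A x ∸ 1)

excess₂ : ∀ {n} → List (Vertex n) → ℕ
excess₂ A = sumᵥ (λ x → (deg A x ∸ 1) C 2)

codegSum : ∀ {n} → List (Vertex n) → ℕ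
codegSum []      = 0
codegSum (a ∷ A) = sum (map (codeg a) A) + codegSum A

deg-⊆ : ∀ {n} (x : Vertex n) {A B} → B ⊆ A → All (Adj x) B → length B ≤ deg A x
deg-⊆ x []           []          = z≤n
deg-⊆ x (a ∷ʳ B⊆A)   x~B         = ≤-trans (deg-⊆ x B⊆A x~B) (m≤n+m _ (adj x a))
deg-⊆ x (refl ∷ B⊆A) (x~a ∷ x~B) rewrite x~a = s≤s (deg-⊆ x B⊆A x~B)

sumᵥ-adj : ∀ {n} (a : Vertex n) → sumᵥ (λ x → adj x a) ≡ n
sumᵥ-adj []              = refl
sumᵥ-adj {suc n} (true  ∷ a) = trans (cong₂ _+_ (sumᵥ-adj a) (sumᵥ-δ≡1 a)) (+-comm n 1)
sumᵥ-adj {suc n} (false ∷ a) = cong₂ _+_ (sumᵥ-δ≡1 a) (sumᵥ-adj a)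

sumᵥ-deg : ∀ {n} (A : List (Vertex n)) → sumᵥ (deg A) ≡ length A * n
sumᵥ-deg {n} []      = sumᵥ-zero {n}
sumᵥ-deg     (a ∷ A) = trans (sumᵥ-+ (λ x → adj x a) (deg A)) (cong₂ _+_ (sumᵥ-adj a) (sumᵥ-deg A))

sumᵥ-adj*deg : ∀ {n} (a : Vertex n) A → sumᵥ (λ x → adj x a * deg A x) ≡ sum (map (codeg a) A)
sumᵥ-adj*deg {n} a [] = trans (sumᵥ-cong (λ x → *-zeroʳ (adj x a))) (sumᵥ-zero {n})
sumᵥ-adj*deg a (b ∷ A) = begin
  sumᵥ (λ x → adj x a * (adj x b + deg A x))
    ≡⟨ sumᵥ-cong (λ x → *-distribˡ-+ (adj x a) (adj x b) (deg A x)) ⟩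
  sumᵥ (λ x → adj x a * adj x b + adj x a * deg A x)
    ≡⟨ sumᵥ-+ (λ x → adj x a * adj x b) (λ x → adj x a * deg A x) ⟩
  codeg a b + sumᵥ (λ x → adj x a * deg A x)
    ≡⟨ cong (codeg a b +_) (sumᵥ-adj*deg a A) ⟩
  codeg a b + sum (map (codeg a) A) ∎
  where open ≡-Reasoning

neighbourhoodSize+excess : ∀ {n} (A : List (Vertex n)) → neighbourhoodSize A + excess A ≡ length A * n
neighbourhoodSize+excess {n} A = begin
  neighbourhoodSize A + excess A         ≡⟨ sym (sumᵥ-+ (λ x → 1 ⊓ deg A x) (λ x → deg A x ∸ 1)) ⟩
  sumᵥ (λ x → 1 ⊓ deg A x + (deg A x ∸ 1)) ≡⟨ sumᵥ-cong (λ x → m⊓n+n∸m≡n 1 (deg A x)) ⟩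
  sumᵥ (deg A)                           ≡⟨ sumᵥ-deg A ⟩
  length A * n                           ∎
  where open ≡-Reasoning

sumᵥ-C₂-deg : ∀ {n} (A : List (Vertex n)) → sumᵥ (λ x → deg A x C 2) ≡ codegSum A
sumᵥ-C₂-deg {n} []  = sumᵥ-zero {n}
sumᵥ-C₂-deg (a ∷ A) = begin
  sumᵥ (λ x → (adj x a + deg A x) C 2)
    ≡⟨ sumᵥ-cong (λ x → C₂-𝟙+ (hamming x a ≡ᵇ 1) (deg A x)) ⟩
  sumᵥ (λ x → adj x a * deg A x + deg A x C 2)
    ≡⟨ sumᵥ-+ (λ x → adj x a * deg A x) (λ x → deg A x C 2) ⟩
  sumᵥ (λ x → adj x a * deg A x) + sumᵥ (λ x → deg A x C 2)
    ≡⟨ cong₂ _+_ (sumᵥ-adj*deg a A) (sumᵥ-C₂-deg A) ⟩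
  codegSum (a ∷ A) ∎
  where open ≡-Reasoning

excess+excess₂ : ∀ {n} (A : List (Vertex n)) → excess A + excess₂ A ≡ codegSum A
excess+excess₂ A = begin
  excess A + excess₂ A
    ≡⟨ sym (sumᵥ-+ (λ x → deg A x ∸ 1) (λ x → (deg A x ∸ 1) C 2)) ⟩
  sumᵥ (λ x → (deg A x ∸ 1) + (deg A x ∸ 1) C 2)
    ≡⟨ sumᵥ-cong (λ x → pascal (deg A x)) ⟩
  sumᵥ (λ x → deg A x C 2)
    ≡⟨ sumᵥ-C₂-deg A ⟩
  codegSum A ∎
  where
  open ≡-Reasoning
  pascal : ∀ d → (d ∸ 1) + (d ∸ 1) C 2 ≡ d C 2
  pascal zero    = refl
  pascal (suc k) = sym (C₂-suc k)

excess-∷ : ∀ {n} (a : Vertex n) A → excess (a ∷ A) ≤ excess A + sum (map (codeg a) A)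
excess-∷ a A = begin
  sumᵥ (λ x → (adj x a + deg A x) ∸ 1)
    ≤⟨ sumᵥ-mono-≤ (λ x → step (hamming x a ≡ᵇ 1) (deg A x)) ⟩
  sumᵥ (λ x → (deg A x ∸ 1) + adj x a * deg A x)
    ≡⟨ sumᵥ-+ (λ x → deg A x ∸ 1) (λ x → adj x a * deg A x) ⟩
  excess A + sumᵥ (λ x → adj x a * deg A x)
    ≡⟨ cong (excess A +_) (sumᵥ-adj*deg a A) ⟩
  excess A + sum (map (codeg a) A) ∎
  where
  open ≤-Reasoning
  step : ∀ b d → (𝟙 b + d) ∸ 1 ≤ (d ∸ 1) + 𝟙 b * d
  step false d = m≤m+n (d ∸ 1) 0
  step true  d = ≤-trans (m≤n+m d (d ∸ 1)) (+-monoʳ-≤ (d ∸ 1) (m≤m+n d 0))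

codegs-≤ : ∀ {n} {a : Vertex n} {A} → All (a ≢_) A → sum (map (codeg a) A) ≤ 2 * length A
codegs-≤                 []            = z≤n
codegs-≤ {A = _ ∷ A} (a≢b ∷ a≢A) =
  ≤-trans (+-mono-≤ (codeg-≤ a≢b) (codegs-≤ a≢A)) (≤-reflexive (sym (*-suc 2 (length A))))

excess-≤ : ∀ {n} {A : List (Vertex n)} → Distinct A → excess A ≤ 2 * (length A C 2)
excess-≤ {n} {[]}        []            = ≤-reflexive (sumᵥ-zero {n})
excess-≤ {A = a ∷ A} (a≢A ∷ distA) = begin
  excess (a ∷ A)                        ≤⟨ excess-∷ a A ⟩
  excess A + sum (map (codeg a) A)      ≤⟨ +-mono-≤ (excess-≤ distA) (codegs-≤ a≢A) ⟩
  2 * (length A C 2) + 2 * length A     ≡⟨ 2C₂-suc (length A) ⟩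
  2 * (suc (length A) C 2)              ∎
  where open ≤-Reasoning

-- Four points

-- The closeness pattern of four points a, b, c, d records which of the pairs ab, ac, ad,
-- bc, bd, cd are at distance 2, in this order.

closeCount : Vec Bool 6 → ℕ
closeCount (ab ∷ ac ∷ ad ∷ bc ∷ bd ∷ cd ∷ []) = 𝟙 ab + 𝟙 ac + 𝟙 ad + 𝟙 bc + 𝟙 bd + 𝟙 cd

hasTriangle : Vec Bool 6 → Bool
hasTriangle (ab ∷ ac ∷ ad ∷ bc ∷ bd ∷ cd ∷ []) =
  (ab ∧ ac ∧ bc) ∨ (ab ∧ ad ∧ bd) ∨ (ac ∧ ad ∧ cd) ∨ (bc ∧ bd ∧ cd)

allClose : Vec Bool 6 → Bool
allClose (ab ∷ ac ∷ ad ∷ bc ∷ bd ∷ cd ∷ []) = ab ∧ ac ∧ ad ∧ bc ∧ bd ∧ cd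

-- The lower bound on excess₂ that a closeness pattern forces (FourPoints.surplus-≤).
surplus : Vec Bool 6 → ℕ
surplus p = if allClose p then 3 else 𝟙 (hasTriangle p)

-- Checked on all 2^6 patterns by evaluating the search for a counterexample.
closeCount-≤ : ∀ p → 2 * closeCount p ≤ 9 + surplus p
closeCount-≤ = ∀ᵥ-by-search (λ p → 2 * closeCount p ≤? 9 + surplus p) _

∧-split : ∀ {x y} → T (x ∧ y) → T x × T y
∧-split = Equivalence.to T-∧

∧₃-split : ∀ {x y z} → T (x ∧ y ∧ z) → T x × T y × T z
∧₃-split t = let (x , yz) = ∧-split t in x , ∧-split yz

∨-split : ∀ {x y} → T (x ∨ y) → T x ⊎ T y
∨-split = Equivalence.to T-∨

module FourPoints {n} (a b c d : Vertex n) where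

  Q : List (Vertex n)
  Q = a ∷ b ∷ c ∷ d ∷ []

  closeness : Vec Bool 6
  closeness = close a b ∷ close a c ∷ close a d ∷ close b c ∷ close b d ∷ close c d ∷ []

  excess₂-at : Vertex n → ℕ
  excess₂-at x = (deg Q x ∸ 1) C 2

  adjacent-C₂ : ∀ m {B} → All (Adj m) B → B ⊆ Q → (length B ∸ 1) C 2 ≤ excess₂-at m
  adjacent-C₂ m m~B B⊆Q = C₂-mono-≤ (∸-monoˡ-≤ 1 (deg-⊆ m B⊆Q m~B))

  abc⊆Q : (a ∷ b ∷ c ∷ []) ⊆ Q
  abc⊆Q = refl ∷ refl ∷ refl ∷ d ∷ʳ []

  abd⊆Q : (a ∷ b ∷ d ∷ []) ⊆ Q
  abd⊆Q = refl ∷ refl ∷ c ∷ʳ refl ∷ []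

  acd⊆Q : (a ∷ c ∷ d ∷ []) ⊆ Q
  acd⊆Q = refl ∷ b ∷ʳ refl ∷ refl ∷ []

  bcd⊆Q : (b ∷ c ∷ d ∷ []) ⊆ Q
  bcd⊆Q = a ∷ʳ refl ∷ refl ∷ refl ∷ []

  triangle : ∀ u v w → T (close u v) → T (close u w) → T (close v w) → (u ∷ v ∷ w ∷ []) ⊆ Q →
             1 ≤ excess₂ Q
  triangle u v w uv uw vw uvw⊆Q =
    ≤-trans (adjacent-C₂ (median u v w) (median-adjacent-close u v w uv uw vw) uvw⊆Q)
            (term-≤-sumᵥ excess₂-at (median u v w))

  adjacent-to-all : ∀ m → All (Adj m) Q → 3 ≤ excess₂ Q
  adjacent-to-all m m~Q = ≤-trans (adjacent-C₂ m m~Q ⊆-refl) (term-≤-sumᵥ excess₂-at m)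

  three-vertices : ∀ {m₁ m₂ m₃} → Distinct (m₁ ∷ m₂ ∷ m₃ ∷ []) →
                   1 ≤ excess₂-at m₁ → 1 ≤ excess₂-at m₂ → 1 ≤ excess₂-at m₃ → 3 ≤ excess₂ Q
  three-vertices distinct p₁ p₂ p₃ =
    ≤-trans (+-mono-≤ p₁ (+-mono-≤ p₂ (+-mono-≤ p₃ z≤n))) (sum-map-≤-sumᵥ excess₂-at distinct)

  K₄ : T (close a b) → T (close a c) → T (close a d) → T (close b c) → T (close b d) → T (close c d) →
       3 ≤ excess₂ Q
  K₄ ab ac ad bc bd cd
    with median-adjacent-close a b c ab ac bc | median-adjacent-close a b d ab ad bd
       | median-adjacent-close a c d ac ad cd
  ... | m₁~abc@(m₁~a ∷ m₁~b ∷ m₁~c ∷ []) | m₂~abd@(m₂~a ∷ m₂~b ∷ m₂~d ∷ [])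
      | m₃~acd@(_ ∷ m₃~c ∷ m₃~d ∷ [])
    with median a b c ≟ᵥ median a b d | median a b c ≟ᵥ median a c d | median a b d ≟ᵥ median a c d
  ... | yes m₁≡m₂ | _ | _ =
    adjacent-to-all (median a b c) (m₁~a ∷ m₁~b ∷ m₁~c ∷ subst (λ m → Adj m d) (sym m₁≡m₂) m₂~d ∷ [])
  ... | no _ | yes m₁≡m₃ | _ =
    adjacent-to-all (median a b c) (m₁~a ∷ m₁~b ∷ m₁~c ∷ subst (λ m → Adj m d) (sym m₁≡m₃) m₃~d ∷ [])
  ... | no _ | no _ | yes m₂≡m₃ =
    adjacent-to-all (median a b d) (m₂~a ∷ m₂~b ∷ subst (λ m → Adj m c) (sym m₂≡m₃) m₃~c ∷ m₂~d ∷ [])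
  ... | no m₁≢m₂ | no m₁≢m₃ | no m₂≢m₃ =
    three-vertices ((m₁≢m₂ ∷ m₁≢m₃ ∷ []) ∷ (m₂≢m₃ ∷ []) ∷ [] ∷ [])
      (adjacent-C₂ (median a b c) m₁~abc abc⊆Q) (adjacent-C₂ (median a b d) m₂~abd abd⊆Q)
      (adjacent-C₂ (median a c d) m₃~acd acd⊆Q)

  surplus-≤ : surplus closeness ≤ excess₂ Q
  surplus-≤ with allClose closeness in all-eq
  ... | true =
    let (ab , t₁) = ∧-split (subst T (sym all-eq) _); (ac , t₂) = ∧-split t₁; (ad , t₃) = ∧-split t₂
        (bc , t₄) = ∧-split t₃; (bd , cd) = ∧-split t₄
    in K₄ ab ac ad bc bd cd
  ... | false with hasTriangle closeness in triangle-eq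
  ...   | false = z≤n
  ...   | true with ∨-split (subst T (sym triangle-eq) _)
  ...     | inj₁ abc = let (ab , ac , bc) = ∧₃-split abc in triangle a b c ab ac bc abc⊆Q
  ...     | inj₂ t with ∨-split t
  ...       | inj₁ abd = let (ab , ad , bd) = ∧₃-split abd in triangle a b d ab ad bd abd⊆Q
  ...       | inj₂ t′ with ∨-split t′
  ...         | inj₁ acd = let (ac , ad , cd) = ∧₃-split acd in triangle a c d ac ad cd acd⊆Q
  ...         | inj₂ bcd = let (bc , bd , cd) = ∧₃-split bcd in triangle b c d bc bd cd bcd⊆Q

  codegSum-closeness : Distinct Q → codegSum Q ≡ 2 * closeCount closeness
  codegSum-closeness ((a≢b ∷ a≢c ∷ a≢d ∷ []) ∷ (b≢c ∷ b≢d ∷ []) ∷ (c≢d ∷ []) ∷ [] ∷ [])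
    rewrite codeg-≢ a≢b | codeg-≢ a≢c | codeg-≢ a≢d | codeg-≢ b≢c | codeg-≢ b≢d | codeg-≢ c≢d =
    regroup (𝟙 (close a b)) (𝟙 (close a c)) (𝟙 (close a d))
            (𝟙 (close b c)) (𝟙 (close b d)) (𝟙 (close c d))
    where
    regroup : ∀ x₁ x₂ x₃ x₄ x₅ x₆ →
      (2 * x₁ + (2 * x₂ + (2 * x₃ + 0))) + ((2 * x₄ + (2 * x₅ + 0)) + ((2 * x₆ + 0) + 0)) ≡
      2 * (x₁ + x₂ + x₃ + x₄ + x₅ + x₆)
    regroup = solve-∀

  excess-≤9 : Distinct Q → excess Q ≤ 9
  excess-≤9 distinct = +-cancelʳ-≤ (excess₂ Q) (excess Q) 9 (begin
    excess Q + excess₂ Q       ≡⟨ excess+excess₂ Q ⟩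
    codegSum Q                 ≡⟨ codegSum-closeness distinct ⟩
    2 * closeCount closeness   ≤⟨ closeCount-≤ closeness ⟩
    9 + surplus closeness      ≤⟨ +-monoʳ-≤ 9 surplus-≤ ⟩
    9 + excess₂ Q              ∎)
    where open ≤-Reasoning

excess-≤₄ : ∀ {n} {A : List (Vertex n)} → Distinct A → 4 ≤ length A → excess A + 3 ≤ 2 * (length A C 2)
excess-≤₄ {A = a ∷ b ∷ c ∷ d ∷ []}                 distinct      _ =
  +-monoˡ-≤ 3 (FourPoints.excess-≤9 a b c d distinct)
excess-≤₄ {A = a ∷ A@(_ ∷ _ ∷ _ ∷ _ ∷ _)} (a≢A ∷ distA) _ = begin
  excess (a ∷ A) + 3                      ≤⟨ +-monoˡ-≤ 3 (excess-∷ a A) ⟩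
  excess A + sum (map (codeg a) A) + 3    ≡⟨ xy∙z≈xz∙y (excess A) _ 3 ⟩
  excess A + 3 + sum (map (codeg a) A)    ≤⟨ +-mono-≤ (excess-≤₄ distA (s≤s (s≤s (s≤s (s≤s z≤n)))))
                                                      (codegs-≤ a≢A) ⟩
  2 * (length A C 2) + 2 * length A       ≡⟨ 2C₂-suc (length A) ⟩
  2 * (suc (length A) C 2)                ∎
  where open ≤-Reasoning
excess-≤₄ {A = []}                _ ()
excess-≤₄ {A = _ ∷ []}            _ (s≤s ())
excess-≤₄ {A = _ ∷ _ ∷ []}        _ (s≤s (s≤s ()))
excess-≤₄ {A = _ ∷ _ ∷ _ ∷ []}    _ (s≤s (s≤s (s≤s ())))

neighbourhood-≥ : ∀ {n} {A : List (Vertex n)} → Distinct A →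
                  length A * n ≤ neighbourhoodSize A + 2 * (length A C 2)
neighbourhood-≥ {n} {A} distA = begin
  length A * n                           ≡⟨ sym (neighbourhoodSize+excess A) ⟩
  neighbourhoodSize A + excess A         ≤⟨ +-monoʳ-≤ (neighbourhoodSize A) (excess-≤ distA) ⟩
  neighbourhoodSize A + 2 * (length A C 2) ∎
  where open ≤-Reasoning

neighbourhood-≥₄ : ∀ {n} {A : List (Vertex n)} → Distinct A → 4 ≤ length A →
                   length A * n + 3 ≤ neighbourhoodSize A + 2 * (length A C 2)
neighbourhood-≥₄ {n} {A} distA 4≤|A| = begin
  length A * n + 3                       ≡⟨ cong (_+ 3) (sym (neighbourhoodSize+excess A)) ⟩
  neighbourhoodSize A + excess A + 3     ≡⟨ +-assoc (neighbourhoodSize A) (excess A) 3 ⟩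
  neighbourhoodSize A + (excess A + 3)   ≤⟨ +-monoʳ-≤ (neighbourhoodSize A) (excess-≤₄ distA 4≤|A|) ⟩
  neighbourhoodSize A + 2 * (length A C 2) ∎
  where open ≤-Reasoning

-- Numberings

strfAtLeast? : ∀ {n} (f : Numbering n) K → Dec (StrfAtLeast f K)
strfAtLeast? f K = ∃ᵥ? λ u → ∃ᵥ? λ v → (hamming u v ≟ 1) ×-dec (K ≤? label f u + label f v)

StrAtLeast-≤ : ∀ {n K K′} → K′ ≤ K → StrAtLeast n K → StrAtLeast n K′
StrAtLeast-≤ K′≤K str f = let (u , v , u~v , K≤) = str f in u , v , u~v , ≤-trans K′≤K K≤

module TopVertices {n} (f : Numbering n) where
  open Bijection f using (to; injective; strictlySurjective)

  private
    below-top : ∀ {k} → suc k ≤ 2 ^ n → 2 ^ n ∸ suc k < 2 ^ n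
    below-top k<2ⁿ = ∸-monoʳ-< {o = 0} (s≤s z≤n) k<2ⁿ

    vertexLabelled : ∀ {k} → suc k ≤ 2 ^ n → Vertex n
    vertexLabelled k<2ⁿ = proj₁ (strictlySurjective (fromℕ< (below-top k<2ⁿ)))

    vertexLabelled-label : ∀ {k} (k<2ⁿ : suc k ≤ 2 ^ n) → toℕ (to (vertexLabelled k<2ⁿ)) ≡ 2 ^ n ∸ suc k
    vertexLabelled-label k<2ⁿ =
      trans (cong toℕ (proj₂ (strictlySurjective _))) (toℕ-fromℕ< (below-top k<2ⁿ))

  top : ∀ k → k ≤ 2 ^ n → List (Vertex n)
  top zero    _    = []
  top (suc k) k<2ⁿ = vertexLabelled k<2ⁿ ∷ top k (<⇒≤ k<2ⁿ)

  top-length : ∀ k (k≤2ⁿ : k ≤ 2 ^ n) → length (top k k≤2ⁿ) ≡ k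
  top-length zero    _    = refl
  top-length (suc k) k<2ⁿ = cong suc (top-length k (<⇒≤ k<2ⁿ))

  top-labels : ∀ k (k≤2ⁿ : k ≤ 2 ^ n) → All (λ v → 2 ^ n ∸ k ≤ toℕ (to v)) (top k k≤2ⁿ)
  top-labels zero    _    = []
  top-labels (suc k) k<2ⁿ = ≤-reflexive (sym (vertexLabelled-label k<2ⁿ))
    ∷ All.map (≤-trans (∸-monoʳ-≤ (2 ^ n) (n≤1+n k))) (top-labels k (<⇒≤ k<2ⁿ))

  top-distinct : ∀ k (k≤2ⁿ : k ≤ 2 ^ n) → Distinct (top k k≤2ⁿ)
  top-distinct zero    _    = []
  top-distinct (suc k) k<2ⁿ = All.map differ (top-labels k (<⇒≤ k<2ⁿ)) ∷ top-distinct k (<⇒≤ k<2ⁿ)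
    where
    differ : ∀ {v} → 2 ^ n ∸ k ≤ toℕ (to v) → vertexLabelled k<2ⁿ ≢ v
    differ {v} above refl = <⇒≢ (≤-trans (∸-monoʳ-< ≤-refl k<2ⁿ) above) (sym (vertexLabelled-label k<2ⁿ))

  few-neighbours : ∀ {k} t A → All (λ a → 2 ^ n ∸ k ≤ toℕ (to a)) A →
                   (∀ u v → Adj u v → label f u + label f v < suc t + suc (2 ^ n ∸ k)) →
                   neighbourhoodSize A ≤ t
  few-neighbours {k} t A high light =
    ≤-trans (sumᵥ-mono-≤ (labelled-below A high)) (count-<-≤ (toℕ ∘ to) (injective ∘ toℕ-injective) t)
    where
    labelled-below : ∀ A → All (λ a → 2 ^ n ∸ k ≤ toℕ (to a)) A → ∀ x → 1 ⊓ deg A x ≤ 𝟙 (toℕ (to x) <ᵇ t)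
    labelled-below []      []              x = z≤n
    labelled-below (a ∷ A) (a-high ∷ high) x with hamming x a ≡ᵇ 1 in x~a
    ... | false = labelled-below A high x
    ... | true  = ≤-trans (m⊓n≤m 1 (suc (deg A x))) (≤-reflexive (sym (𝟙-T (<⇒<ᵇ x-low))))
      where
      x-low : toℕ (to x) < t
      x-low = ≤-pred (+-cancelʳ-< (suc (2 ^ n ∸ k)) (label f x) (suc t)
                (≤-<-trans (+-monoʳ-≤ (label f x) (s≤s a-high))
                           (light x a (≡ᵇ⇒≡ (hamming x a) 1 (subst T (sym x~a) _)))))

str-≥ : ∀ {n} k t → k ≤ 2 ^ n → (∀ A → Distinct A → length A ≡ k → t < neighbourhoodSize A) →
        StrAtLeast n (suc t + suc (2 ^ n ∸ k))
str-≥ {n} k t k≤2ⁿ expanding f with strfAtLeast? f (suc t + suc (2 ^ n ∸ k))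
... | yes heavy = heavy
... | no  ¬heavy = ⊥-elim (<⇒≱ (expanding A (top-distinct k k≤2ⁿ) (top-length k k≤2ⁿ))
                                (few-neighbours {k} t A (top-labels k k≤2ⁿ) light))
  where
  open TopVertices f
  A = top k k≤2ⁿ
  light : ∀ u v → Adj u v → label f u + label f v < suc t + suc (2 ^ n ∸ k)
  light u v u~v = ≰⇒> (λ heavy → ¬heavy (u , v , u~v , heavy))

str-≥-union : ∀ {n} k t → k ≤ 2 ^ n → suc t + 2 * (k C 2) ≤ k * n →
              StrAtLeast n (suc t + suc (2 ^ n ∸ k))
str-≥-union {n} k t k≤2ⁿ enough = str-≥ k t k≤2ⁿ λ A distA |A|≡k →
  +-cancelʳ-≤ (2 * (k C 2)) (suc t) (neighbourhoodSize A)
    (≤-trans enough (subst (λ l → l * n ≤ neighbourhoodSize A + 2 * (l C 2)) |A|≡k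
                           (neighbourhood-≥ distA)))

str-≥-four : ∀ {n} k t → 4 ≤ k → k ≤ 2 ^ n → suc t + 2 * (k C 2) ≤ k * n + 3 →
             StrAtLeast n (suc t + suc (2 ^ n ∸ k))
str-≥-four {n} k t 4≤k k≤2ⁿ enough = str-≥ k t k≤2ⁿ λ A distA |A|≡k →
  +-cancelʳ-≤ (2 * (k C 2)) (suc t) (neighbourhoodSize A)
    (≤-trans enough (subst (λ l → l * n + 3 ≤ neighbourhoodSize A + 2 * (l C 2)) |A|≡k
                           (neighbourhood-≥₄ distA (subst (4 ≤_) (sym |A|≡k) 4≤k))))

n<2^n : ∀ n → n < 2 ^ n
n<2^n zero    = s≤s z≤n
n<2^n (suc n) = +-mono-≤ (m^n>0 2 n) (≤-trans (n<2^n n) (m≤m+n (2 ^ n) 0))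

≤-eval : ∀ {m n} → {T (m ≤ᵇ n)} → m ≤ n
≤-eval {m} {n} {m≤ᵇn} = ≤ᵇ⇒≤ m n m≤ᵇn

small-cubes : StrAtLeast 2 6 × StrAtLeast 3 11 × StrAtLeast 4 21
small-cubes = str-≥-union 1 1 ≤-eval ≤-eval
            , str-≥-union 1 2 ≤-eval ≤-eval
            , str-≥-union 2 5 ≤-eval ≤-eval

medium-cubes : ∀ n → 5 ≤ n → n ≤ 9 → StrAtLeast n ((2 ^ n + 4 * n) ∸ 12)
medium-cubes 5 _ _ = str-≥-four 4 10 ≤-eval ≤-eval ≤-eval
medium-cubes 6 _ _ = str-≥-four 4 14 ≤-eval ≤-eval ≤-eval
medium-cubes 7 _ _ = str-≥-four 4 18 ≤-eval ≤-eval ≤-eval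
medium-cubes 8 _ _ = str-≥-four 4 22 ≤-eval ≤-eval ≤-eval
medium-cubes 9 _ _ = str-≥-four 4 26 ≤-eval ≤-eval ≤-eval
medium-cubes 1 (s≤s ()) _
medium-cubes 2 (s≤s (s≤s ())) _
medium-cubes 3 (s≤s (s≤s (s≤s ()))) _
medium-cubes 4 (s≤s (s≤s (s≤s (s≤s ())))) _
medium-cubes (suc (suc (suc (suc (suc (suc (suc (suc (suc (suc _)))))))))) _
  (s≤s (s≤s (s≤s (s≤s (s≤s (s≤s (s≤s (s≤s (s≤s ())))))))))

even-cubes : ∀ m → 5 ≤ m → StrAtLeast (2 * m) (2 ^ (2 * m) + m * m + 4)
even-cubes m 5≤m =
  StrAtLeast-≤ (≤-reflexive target) (str-≥-four m (m * m + m + 2) (≤-trans ≤-eval 5≤m) m≤2ⁿ enough)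
  where
  p = 2 ^ (2 * m)
  m≤2ⁿ : m ≤ p
  m≤2ⁿ = ≤-trans (m≤m+n m (m + 0)) (<⇒≤ (n<2^n (2 * m)))
  enough : suc (m * m + m + 2) + 2 * (m C 2) ≤ m * (2 * m) + 3
  enough = ≤-reflexive (begin
    suc (m * m + m + 2) + 2 * (m C 2)   ≡⟨ regroup m (2 * (m C 2)) ⟩
    m * m + 3 + (2 * (m C 2) + m)       ≡⟨ cong (m * m + 3 +_) (2C₂+k≡k*k m) ⟩
    m * m + 3 + m * m                   ≡⟨ double m ⟩
    m * (2 * m) + 3                     ∎)
    where
    open ≡-Reasoning
    regroup : ∀ m c → suc (m * m + m + 2) + c ≡ m * m + 3 + (c + m)
    regroup = solve-∀
    double : ∀ m → m * m + 3 + m * m ≡ m * (2 * m) + 3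
    double = solve-∀
  target : p + m * m + 4 ≡ suc (m * m + m + 2) + suc (p ∸ m)
  target = begin
    p + m * m + 4                       ≡⟨ cong (λ q → q + m * m + 4) (sym (m∸n+n≡m m≤2ⁿ)) ⟩
    (p ∸ m) + m + m * m + 4             ≡⟨ regroup (p ∸ m) m ⟩
    suc (m * m + m + 2) + suc (p ∸ m)   ∎
    where
    open ≡-Reasoning
    regroup : ∀ q m → q + m + m * m + 4 ≡ suc (m * m + m + 2) + suc q
    regroup = solve-∀

odd-cubes : ∀ m → 6 ≤ m → StrAtLeast (2 * m ∸ 1) ((2 ^ (2 * m ∸ 1) + m * m) ∸ m + 4)
odd-cubes m@(suc j) 6≤m =
  StrAtLeast-≤ (≤-reflexive target) (str-≥-four m (m * m + 2) (≤-trans ≤-eval 6≤m) m≤2ⁿ enough)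
  where
  p = 2 ^ (2 * m ∸ 1)
  2m∸1≡1+2j : 2 * m ∸ 1 ≡ suc (2 * j)
  2m∸1≡1+2j = +-suc j (j + 0)
  m≤2ⁿ : m ≤ p
  m≤2ⁿ = ≤-trans (subst (m ≤_) (sym 2m∸1≡1+2j) (s≤s (m≤m+n j (j + 0)))) (<⇒≤ (n<2^n (2 * m ∸ 1)))
  enough : suc (m * m + 2) + 2 * (m C 2) ≤ m * (2 * m ∸ 1) + 3
  enough = ≤-reflexive (+-cancelʳ-≡ m _ _ (begin
    suc (m * m + 2) + 2 * (m C 2) + m     ≡⟨ +-assoc (suc (m * m + 2)) _ m ⟩
    suc (m * m + 2) + (2 * (m C 2) + m)   ≡⟨ cong (suc (m * m + 2) +_) (2C₂+k≡k*k m) ⟩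
    suc (m * m + 2) + m * m               ≡⟨ regroup j ⟩
    m * suc (2 * j) + 3 + m               ≡⟨ cong (λ l → m * l + 3 + m) (sym 2m∸1≡1+2j) ⟩
    m * (2 * m ∸ 1) + 3 + m               ∎))
    where
    open ≡-Reasoning
    regroup : ∀ j → suc (suc j * suc j + 2) + suc j * suc j ≡ suc j * suc (2 * j) + 3 + suc j
    regroup = solve-∀
  target : (p + m * m) ∸ m + 4 ≡ suc (m * m + 2) + suc (p ∸ m)
  target = begin
    (p + m * m) ∸ m + 4                 ≡⟨ cong (_+ 4) (+-∸-comm (m * m) m≤2ⁿ) ⟩
    (p ∸ m) + m * m + 4                 ≡⟨ regroup (p ∸ m) (m * m) ⟩
    suc (m * m + 2) + suc (p ∸ m)       ∎
    where
    open ≡-Reasoning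
    regroup : ∀ q s → q + s + 4 ≡ suc (s + 2) + suc q
    regroup = solve-∀

mainTheorem10 :
    (StrAtLeast 2 6 × StrAtLeast 3 11 × StrAtLeast 4 21)
    × (∀ n → 5 ≤ n → n ≤ 9 → StrAtLeast n ((2 ^ n + 4 * n) ∸ 12))
    × (∀ m → 5 ≤ m → StrAtLeast (2 * m) (2 ^ (2 * m) + m * m + 4))
    × (∀ m → 6 ≤ m → StrAtLeast (2 * m ∸ 1) ((2 ^ (2 * m ∸ 1) + m * m) ∸ m + 4))
mainTheorem10 = small-cubes , medium-cubes , even-cubes , odd-cubes
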